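{- Let $G=(V,E)$ be a connected graph with $n\ge 2$ vertices, $b$ an integer with $1\le b<n$, $\mathcal{D}$ a fixed rooted spanning tree of $G$, and $\phi$ a segment assignment. Let $s_0,s_1,\dots,s_n$ be states such that $s_{k+1}$ is an extension of $s_k$ for every $0\le k<n$ (so $|\mathrm{dom}(s_k)|=k$ when $s_0$ is the empty state). For $1\le k\le n$ let $v_k$ be the vertex in $\mathrm{dom}(s_k)\setminus\mathrm{dom}(s_{k-1})$. Then the ordering $\pi$ that assigns to $v_k$ the $k$-th position in the color order is a $b$-ordering.
   Context: A $b$-ordering is a bijection $\pi:V\to\{1,\dots,n\}$ with $|\pi(u)-\pi(v)|\le b$ for every $uv\in E$. For integers $i<j$, the segment $\Theta_{(i,j)}$ is $\{i(b+1)+1,\dots,j(b+1)\}\cap\{1,\dots,n\}$, considered only when nonempty; $\Theta_i:=\Theta_{(i,i+1)}$ are base segments. For a position $p$, $\mathtt{segment}(p)=\lceil p/(b+1)\rceil$, $\mathtt{color}(p)=((p-1)\bmod(b+1))+1$; the color order sorts positions $1,\dots,n$ lexicographically by $(\mathtt{color}(p),\mathtt{segment}(p))$. In $\mathcal{D}$, a leaf is a non-root vertex with no children; other vertices (including the root) are inner. A segment assignment is a function $\phi$ assigning a segment to every vertex such that: (1) every leaf gets a segment $\Theta_{(i,i+4)}$; (2) every inner vertex gets a segment $\Theta_{(i,i+2)}$; (3) if $u$ is the parent of an inner vertex $v$ in $\mathcal{D}$, $\phi(u)=\Theta_{(i,i+2)}$, $\phi(v)=\Theta_{(j,j+2)}$,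 then $|i-j|=1$; (4) if $v$ is a leaf with parent $u$ and $\phi(u)=\Theta_{(i,i+2)}$, then $\phi(v)=\Theta_{(i-1,i+3)}$. A state candidate is a partial function $s$ from $V$ to $\{\Theta_i: 0\le i<\lceil n/(b+1)\rceil\}$ such that $s(v)\subseteq\phi(v)$ whenever $s(v)$ is defined; $\mathrm{dom}(s)$ is its domain. A state is a state candidate $s$ such that: (1) the vertices of $\mathrm{dom}(s)$ can be bijectively assigned to the first $|\mathrm{dom}(s)|$ positions in the color order so that each $v$ gets a position in $s(v)$; (2) for every edge $uv\in E$: either both $s(u),s(v)$ are undefined; or exactly one is defined, say $s(v)=\Theta_i$ and $s(u)$ undefined, and then, writing $\phi(u)=\Theta_{(k,l)}$, we have $k\le i$; or both are defined, $s(v)=\Theta_i$, $s(u)=\Theta_k$, and $|i-k|\le1$. A state $s'$ is an extension of a state $s$ if there is a vertex $v$ with: $s(v)$ undefined and $s'(v)$ defined; $\mathrm{dom}(s')=\mathrm{dom}(s)\cup\{v\}$ and $s'$ restricted to $\mathrm{dom}(s)$ equals $s$; and for every edge $uv\in E$ with $s'(u)=\Theta_k$ and $s'(v)=\Theta_i$, we have $k-1\le i\le k$. -}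

module Defs where

open import Data.Nat as ℕ using (ℕ; zero; suc; _+_; _*_; _∸_; _≤_; _<_; ∣_-_∣; _<ᵇ_; _≡ᵇ_)
open import Data.Nat.DivMod using (_/_; _%_)
open import Data.Integer as ℤ using (ℤ; +_)
open import Data.Bool using (Bool; _∨_; _∧_)
open import Data.Fin using (Fin)
open import Data.Maybe using (Maybe; just; nothing; _>>=_)
open import Data.List using (List; length; map; upTo; filterᵇ)
open import Data.Product using (Σ; ∃; ∃-syntax; _×_; _,_)
open import Relation.Nullary using (¬_)
open import Relation.Binary.PropositionalEquality using (_≡_; _≢_)

record SimpleGraph {n : ℕ} (E : Fin n → Fin n → Set) : Set where
  field
    sym   : ∀ u v → E u v → E v u
    irrefl : ∀ v → ¬ E v v

data Walk {n : ℕ} (E : Fin n → Fin n → Set) : Fin n → Fin n → Set where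
  [] : ∀ {v} → Walk E v v
  step : ∀ {u v w} → E u v → Walk E v w → Walk E u w

Connected : {n : ℕ} → (Fin n → Fin n → Set) → Set
Connected {n} E = ∀ (u v : Fin n) → Walk E u v

ancestor : {n : ℕ} → (Fin n → Maybe (Fin n)) → ℕ → Fin n → Maybe (Fin n)
ancestor par zero    v = just v
ancestor par (suc k) v = ancestor par k v >>= par

record RootedSpanningTree {n : ℕ} (E : Fin n → Fin n → Set) : Set where
  field
    root   : Fin n
    parent : Fin n → Maybe (Fin n)
    parent-root : parent root ≡ nothing
    parent-edge : ∀ v → v ≢ root → ∃[ u ] (parent v ≡ just u × E v u)
    reaches-root : ∀ v → ∃[ k ] (ancestor parent k v ≡ just root)

IsLeaf : {n : ℕ} {E : Fin n → Fin n → Set} → RootedSpanningTree E → Fin n → Set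
IsLeaf {n} D v = (v ≢ RootedSpanningTree.root D)
               × (∀ (u : Fin n) → RootedSpanningTree.parent D u ≢ just v)

IsInner : {n : ℕ} {E : Fin n → Fin n → Set} → RootedSpanningTree E → Fin n → Set
IsInner D v = ¬ IsLeaf D v

-- p ∈ Θ_(i,j) = {i(b+1)+1, …, j(b+1)} ∩ {1,…,n}   (i, j integers)
InSeg : (n b : ℕ) → ℤ → ℤ → ℕ → Set
InSeg n b i j p = (1 ≤ p) × (p ≤ n)
                × (i ℤ.* + suc b ℤ.+ + 1 ℤ.≤ + p) × (+ p ℤ.≤ j ℤ.* + suc b)

InBase : (n b : ℕ) → ℕ → ℕ → Set
InBase n b i p = InSeg n b (+ i) (+ suc i) p

ceilDiv : ℕ → (b : ℕ) → ℕ
ceilDiv m b = (m + b) / suc b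

segment : (b p : ℕ) → ℕ
segment b p = ceilDiv p b

color : (b p : ℕ) → ℕ
color b p = suc ((p ∸ 1) % suc b)

colorLess : (b q p : ℕ) → Bool
colorLess b q p = (color b q <ᵇ color b p)
                ∨ ((color b q ≡ᵇ color b p) ∧ (segment b q <ᵇ segment b p))

positions : ℕ → List ℕ
positions n = map suc (upTo n)

-- number of positions preceding p in the color order (0-based rank);
-- the k-th position in the color order (k ≥ 1) is the p ∈ {1..n} with rank k-1
colorRank : (n b p : ℕ) → ℕ
colorRank n b p = length (filterᵇ (λ q → colorLess b q p) (positions n))

IsBOrdering : {n : ℕ} → (Fin n → Fin n → Set) → ℕ → (Fin n → ℕ) → Set
IsBOrdering {n} E b π =
    (∀ v → (1 ≤ π v) × (π v ≤ n))
  × (∀ u v → π u ≡ π v → u ≡ v)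
  × (∀ p → 1 ≤ p → p ≤ n → ∃[ v ] (π v ≡ p))
  × (∀ u v → E u v → ∣ π u - π v ∣ ≤ b)

record SegmentAssignment {n : ℕ} {E : Fin n → Fin n → Set}
                         (b : ℕ) (D : RootedSpanningTree E) : Set where
  open RootedSpanningTree D
  field
    lo hi : Fin n → ℤ
    nonempty   : ∀ v → ∃[ p ] InSeg n b (lo v) (hi v) p
    leaf-width  : ∀ v → IsLeaf D v → hi v ≡ lo v ℤ.+ + 4
    inner-width : ∀ v → IsInner D v → hi v ≡ lo v ℤ.+ + 2
    parent-inner : ∀ u v → parent v ≡ just u → IsInner D v
                 → ℤ.∣ lo u ℤ.- lo v ∣ ≡ 1
    parent-leaf : ∀ u v → parent v ≡ just u → IsLeaf D v
                → (lo v ≡ lo u ℤ.- + 1) × (hi v ≡ lo u ℤ.+ + 3)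

-- State candidates and states.  s v = just i  means  s(v) = Θ_i.

StateCand : ℕ → Set
StateCand n = Fin n → Maybe ℕ

domSize : {n : ℕ} → StateCand n → ℕ
domSize {n} s = length (filterᵇ (λ v → Data.Maybe.is-just (s v)) (Data.List.allFin n))
  where import Data.Maybe; import Data.List

module _ {n : ℕ} {E : Fin n → Fin n → Set} {b : ℕ} {D : RootedSpanningTree E}
         (φ : SegmentAssignment b D) where
  open SegmentAssignment φ

  IsStateCandidate : StateCand n → Set
  IsStateCandidate s = ∀ v i → s v ≡ just i →
      (i < ceilDiv n b)
    × (∀ p → InBase n b i p → InSeg n b (lo v) (hi v) p)

  IsState : StateCand n → Set
  IsState s = IsStateCandidate s
    -- (1) bijective assignment of dom(s) to the first |dom(s)| positions
    --     in the color order, each v getting a position in s(v)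
    × (Σ (Fin n → ℕ) λ f → ( (∀ v i → s v ≡ just i →
                   InBase n b i (f v) × (colorRank n b (f v) < domSize s))
              × (∀ u v i j → s u ≡ just i → s v ≡ just j → f u ≡ f v → u ≡ v)
              × (∀ p → 1 ≤ p → p ≤ n → colorRank n b p < domSize s →
                   ∃[ v ] ∃[ i ] (s v ≡ just i × f v ≡ p))))
    × (∀ u v → E u v → ∀ i → s v ≡ just i →
          ((s u ≡ nothing → lo u ℤ.≤ + i)
         × (∀ k → s u ≡ just k → ∣ i - k ∣ ≤ 1)))

  IsExtension : StateCand n → StateCand n → Set
  IsExtension s s' = ∃[ v ]
      ( (s v ≡ nothing)
      × (∃[ i ] (s' v ≡ just i))
      × (∀ u → u ≢ v → s' u ≡ s u)
      × (∀ u k i → E u v → s' u ≡ just k → s' v ≡ just i → (k ∸ 1 ≤ i) × (i ≤ k)))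

-- Each extension adds one vertex, so |dom s_k| = k, and π puts the vertex v inserted at stage k
-- (from s_k to s_{k+1}) on the position p of rank k in the colour order. The crux is that p lies
-- in the base segment Θ_i = s_{k+1}(v). Otherwise p ∈ Θ_j for some j ≠ i. The position assignment
-- of s_{k+1} matches the positions of Θ_j among the first k+1 of the colour order with vertices
-- of segment Θ_j; none of them is v, so all belong to s_k, and the assignment of s_k maps them
-- injectively into the positions of Θ_j among the first k: a proper subset, as it misses p.
-- For an edge uv with u inserted first, the extension condition puts π(v) in the base segment
-- of π(u) or in the one before it. In the first case |π(u) − π(v)| ≤ b; in the second, π(u)
-- preceding π(v) in the colour order while lying in a later segment forces
-- color(π u) < color(π v), which again gives distance at most b.
module Submission where

open import Defs
open import Level using (Level)
open import Data.Nat as ℕ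
  using (ℕ; zero; suc; _+_; _*_; _∸_; _<_; _≤_; _<?_; _⊔_; z≤n; s≤s; s≤s⁻¹; ∣_-_∣)
open import Data.Nat.Properties
open import Data.Nat.DivMod
  using (_/_; _%_; m%n<n; m≡m%n+[m/n]*n; m/n≡1+[m∸n]/n; m<n*o⇒m/o<n; m*n/n≡m; /-monoˡ-≤)
open import Data.Integer as ℤ using (+_)
import Data.Integer.Properties as ℤ
open import Data.Bool using (T)
open import Data.Bool.Properties using (T-∨; T-∧)
open import Data.Unit using (tt)
open import Data.Fin using (Fin)
import Data.Fin.Properties as Fin
open import Data.Maybe using (Maybe; just; nothing; is-just)
open import Data.Maybe.Properties using (just-injective)
open import Data.List using ([]; _∷_; length; filter; upTo; downFrom; allFin)
import Data.List.Properties as List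
open import Data.List.Membership.Propositional using (_∈_)
open import Data.List.Membership.Propositional.Properties
  using (∈-map⁺; ∈-upTo⁺; ∈-downFrom⁺; ∈-allFin)
open import Data.List.Relation.Unary.Any as Any using (here; there)
open import Data.Product using (Σ; ∃-syntax; _×_; _,_; proj₁; proj₂)
import Data.Product as Product
open import Data.Product.Relation.Binary.Lex.Strict using (×-strictTotalOrder)
open import Data.Sum using (_⊎_; inj₁; inj₂)
import Data.Sum as Sum
open import Function using (_∘_; id; Equivalence)
open import Relation.Nullary using (¬_; yes; no; ¬?; contradiction; T?)
open import Relation.Nullary.Decidable using (_×-dec_)
open import Relation.Unary using (Pred; Decidable)
open import Relation.Binary.Bundles using (StrictTotalOrder)
open import Relation.Binary.Definitions using (tri<; tri≈; tri>)
open import Relation.Binary.PropositionalEquality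

module _ {a p q : Level} {A : Set a} {P : Pred A p} {Q : Pred A q}
         (P? : Decidable P) (Q? : Decidable Q) where

  length-filter-mono : ∀ xs → (∀ {x} → x ∈ xs → P x → Q x) →
                       length (filter P? xs) ≤ length (filter Q? xs)
  length-filter-mono []       P⇒Q = z≤n
  length-filter-mono (x ∷ xs) P⇒Q
    with P? x | Q? x | length-filter-mono xs (λ x∈ → P⇒Q (there x∈))
  ... | yes _  | yes _  | ih = s≤s ih
  ... | yes px | no ¬qx | _  = contradiction (P⇒Q (here refl) px) ¬qx
  ... | no _   | yes _  | ih = m≤n⇒m≤1+n ih
  ... | no _   | no _   | ih = ih

  length-filter-mono-< : ∀ xs → (∀ {x} → x ∈ xs → P x → Q x) →
                         ∀ {y} → y ∈ xs → ¬ P y → Q y →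
                         length (filter P? xs) < length (filter Q? xs)
  length-filter-mono-< (x ∷ xs) P⇒Q (here refl) ¬py qy with P? x | Q? x
  ... | yes py | _      = contradiction py ¬py
  ... | no _   | no ¬qy = contradiction qy ¬qy
  ... | no _   | yes _  = s≤s (length-filter-mono xs (λ x∈ → P⇒Q (there x∈)))
  length-filter-mono-< (x ∷ xs) P⇒Q (there y∈) ¬py qy
    with P? x | Q? x | length-filter-mono-< xs (λ x∈ → P⇒Q (there x∈)) y∈ ¬py qy
  ... | yes _  | yes _  | ih = s≤s ih
  ... | yes px | no ¬qx | _  = contradiction (P⇒Q (here refl) px) ¬qx
  ... | no _   | yes _  | ih = m≤n⇒m≤1+n ih
  ... | no _   | no _   | ih = ih

count : ∀ {p} {P : Pred ℕ p} → Decidable P → ℕ → ℕ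
count P? N = length (filter P? (downFrom N))

module _ {p q : Level} {P : Pred ℕ p} where

  count-≤-injection : {Q : Pred ℕ q} (P? : Decidable P) (Q? : Decidable Q) (M N : ℕ)
    (g : ∀ {x} → P x → ℕ) →
    (∀ {x} → x < M → (px : P x) → g px < N × Q (g px)) →
    (∀ {x y} (px : P x) (py : P y) → g px ≡ g py → x ≡ y) →
    count P? M ≤ count Q? N
  count-≤-injection P? Q? zero    N g into inj = z≤n
  count-≤-injection {Q} P? Q? (suc m) N g into inj with P? m
  ... | no _   = count-≤-injection P? Q? m N g (λ x<m → into (m<n⇒m<1+n x<m)) inj
  ... | yes pm = begin-strict
      count P? m                 ≤⟨ count-≤-injection P? Q′? m N g into′ inj ⟩
      count Q′? N                <⟨ length-filter-mono-< Q′? Q? (downFrom N) (λ _ → proj₁)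
                                      (∈-downFrom⁺ (proj₁ (into ≤-refl pm))) (λ q′ → proj₂ q′ refl)
                                      (proj₂ (into ≤-refl pm)) ⟩
      count Q? N                 ∎
    where
      open ≤-Reasoning
      Q′ : Pred ℕ q
      Q′ y = Q y × y ≢ g pm
      Q′? : Decidable Q′
      Q′? y = Q? y ×-dec ¬? (y ≟ g pm)
      into′ : ∀ {x} → x < m → (px : P x) → g px < N × Q′ (g px)
      into′ x<m px = proj₁ (into (m<n⇒m<1+n x<m) px)
                   , proj₂ (into (m<n⇒m<1+n x<m) px) , λ eq → <⇒≢ x<m (inj px pm eq)

  no-injection-into-proper-subset : {Q : Pred ℕ q} (P? : Decidable P) (Q? : Decidable Q) (N : ℕ) →
    (∀ {x} → Q x → P x) →
    (g : ∀ {x} → P x → ℕ) →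
    (∀ {x} → x < N → (px : P x) → g px < N × Q (g px)) →
    (∀ {x y} (px : P x) (py : P y) → g px ≡ g py → x ≡ y) →
    ∀ {x} → x < N → P x → Q x
  no-injection-into-proper-subset P? Q? N Q⊆P g into inj {x} x<N px with Q? x
  ... | yes qx = qx
  ... | no ¬qx = contradiction (count-≤-injection P? Q? N N g into inj)
      (<⇒≱ (length-filter-mono-< Q? P? (downFrom N) (λ _ → Q⊆P) (∈-downFrom⁺ x<N) ¬qx px))

∣m+o-n+o∣≡∣m-n∣ : ∀ m n o → ∣ m + o - n + o ∣ ≡ ∣ m - n ∣
∣m+o-n+o∣≡∣m-n∣ m n o = trans (cong₂ ∣_-_∣ (+-comm m o) (+-comm n o)) (∣m+n-m+o∣≡∣n-o∣ o m n)

pred-≤-adjacent : ∀ {a c} → a ∸ 1 ≤ c → c ≤ a → c ≡ a ⊎ suc c ≡ a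
pred-≤-adjacent {zero}  _   c≤0 = inj₁ (n≤0⇒n≡0 c≤0)
pred-≤-adjacent {suc a} a≤c c≤1+a with m≤n⇒m<n∨m≡n c≤1+a
... | inj₁ c<1+a = inj₂ (cong suc (≤-antisym (s≤s⁻¹ c<1+a) a≤c))
... | inj₂ c≡1+a = inj₁ c≡1+a

module Positions (n b : ℕ) where

  -- p is the (offset p + 1)-th position of Θ_(block p); color b p is definitionally suc (offset p).
  block offset : ℕ → ℕ
  block  p = (p ∸ 1) / suc b
  offset p = (p ∸ 1) % suc b

  offset<1+b : ∀ p → offset p < suc b
  offset<1+b p = m%n<n (p ∸ 1) (suc b)

  offset+block : ∀ {p} → 1 ≤ p → p ≡ suc (offset p + block p * suc b)
  offset+block {suc q} _ = cong suc (m≡m%n+[m/n]*n q (suc b))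

  segment≡1+block : ∀ {p} → 1 ≤ p → segment b p ≡ suc (block p)
  segment≡1+block {suc q} _ = begin
    (suc q + b) / suc b            ≡⟨ cong (_/ suc b) (+-suc q b) ⟨
    (q + suc b) / suc b            ≡⟨ m/n≡1+[m∸n]/n (m≤n+m (suc b) q) ⟩
    suc ((q + suc b ∸ suc b) / suc b) ≡⟨ cong (λ m → suc (m / suc b)) (m+n∸n≡m q (suc b)) ⟩
    suc (q / suc b)                ∎
    where open ≡-Reasoning

  inBase⇒bounds : ∀ {i p} → InBase n b i p → i * suc b < p × p ≤ suc i * suc b
  inBase⇒bounds {i} {p} (_ , _ , lo , hi) =
      subst (_≤ p) (+-comm (i * suc b) 1)
        (ℤ.drop‿+≤+ (subst (λ z → z ℤ.+ + 1 ℤ.≤ + p) (sym (ℤ.pos-* i (suc b))) lo))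
    , ℤ.drop‿+≤+ (subst (+ p ℤ.≤_) (sym (ℤ.pos-* (suc i) (suc b))) hi)

  bounds⇒inBase : ∀ {i p} → 1 ≤ p → p ≤ n → i * suc b < p → p ≤ suc i * suc b → InBase n b i p
  bounds⇒inBase {i} {p} 1≤p p≤n lo hi =
      1≤p , p≤n
    , subst (λ z → z ℤ.+ + 1 ℤ.≤ + p) (ℤ.pos-* i (suc b))
        (ℤ.+≤+ (subst (_≤ p) (+-comm 1 (i * suc b)) lo))
    , subst (+ p ℤ.≤_) (ℤ.pos-* (suc i) (suc b)) (ℤ.+≤+ hi)

  block-unique : ∀ {i p} → i * suc b < p → p ≤ suc i * suc b → block p ≡ i
  block-unique {i} {suc q} (s≤s lo) hi = ≤-antisym
    (s≤s⁻¹ (m<n*o⇒m/o<n hi))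
    (subst (_≤ q / suc b) (m*n/n≡m i (suc b)) (/-monoˡ-≤ (suc b) lo))

  inBase⇒block : ∀ {i p} → InBase n b i p → block p ≡ i
  inBase⇒block {i} base = let (lo , hi) = inBase⇒bounds {i} base in block-unique {i} lo hi

  inBase-block : ∀ {p} → 1 ≤ p → p ≤ n → InBase n b (block p) p
  inBase-block {p} 1≤p p≤n = bounds⇒inBase {block p} 1≤p p≤n lo hi
    where
      lo : block p * suc b < p
      lo = subst (block p * suc b <_) (sym (offset+block 1≤p)) (s≤s (m≤n+m _ (offset p)))
      hi : p ≤ suc (block p) * suc b
      hi = subst (_≤ suc (block p) * suc b) (sym (offset+block 1≤p))
             (+-monoˡ-≤ (block p * suc b) (offset<1+b p))

  inBase? : ∀ i → Decidable (InBase n b i)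
  inBase? i p = (1 ℕ.≤? p) ×-dec (p ℕ.≤? n) ×-dec (_ ℤ.≤? _) ×-dec (_ ℤ.≤? _)

  key : ℕ → ℕ × ℕ
  key p = color b p , segment b p

  open StrictTotalOrder (×-strictTotalOrder <-strictTotalOrder <-strictTotalOrder)
    using (compare) renaming (_<_ to _<ₗₑₓ_; irrefl to <ₗₑₓ-irrefl; trans to <ₗₑₓ-trans)

  _≺_ : ℕ → ℕ → Set
  q ≺ p = key q <ₗₑₓ key p

  colorLess⇒≺ : ∀ q p → T (colorLess b q p) → q ≺ p
  colorLess⇒≺ q p = Sum.map (<ᵇ⇒< _ _) (Product.map (≡ᵇ⇒≡ _ _) (<ᵇ⇒< _ _) ∘ Equivalence.to T-∧)
                  ∘ Equivalence.to T-∨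

  ≺⇒colorLess : ∀ q p → q ≺ p → T (colorLess b q p)
  ≺⇒colorLess q p = Equivalence.from T-∨
                  ∘ Sum.map <⇒<ᵇ (Equivalence.from T-∧ ∘ Product.map (≡⇒≡ᵇ _ _) <⇒<ᵇ)

  colorLess-irrefl : ∀ p → ¬ T (colorLess b p p)
  colorLess-irrefl p = <ₗₑₓ-irrefl (refl , refl) ∘ colorLess⇒≺ p p

  key-injective : ∀ {q p} → 1 ≤ q → 1 ≤ p →
                  color b q ≡ color b p → segment b q ≡ segment b p → q ≡ p
  key-injective {q} {p} 1≤q 1≤p same-color same-segment = begin
    q                                 ≡⟨ offset+block 1≤q ⟩
    suc (offset q + block q * suc b)  ≡⟨ cong₂ (λ o β → suc (o + β * suc b))
                                               (suc-injective same-color) same-block ⟩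
    suc (offset p + block p * suc b)  ≡⟨ offset+block 1≤p ⟨
    p                                 ∎
    where
      open ≡-Reasoning
      same-block : block q ≡ block p
      same-block = suc-injective
        (trans (sym (segment≡1+block 1≤q)) (trans same-segment (segment≡1+block 1≤p)))

  ∈-positions : ∀ {p} → 1 ≤ p → p ≤ n → p ∈ positions n
  ∈-positions {suc q} _ p≤n = ∈-map⁺ suc (∈-upTo⁺ p≤n)

  length-positions : length (positions n) ≡ n
  length-positions = trans (List.length-map suc (upTo n)) (List.length-upTo n)

  colorRank-mono-≺ : ∀ {q p} → 1 ≤ q → q ≤ n → q ≺ p → colorRank n b q < colorRank n b p
  colorRank-mono-≺ {q} {p} 1≤q q≤n q≺p =
    length-filter-mono-< (T? ∘ λ x → colorLess b x q) (T? ∘ λ x → colorLess b x p) (positions n)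
      (λ {x} _ x<q → ≺⇒colorLess x p (<ₗₑₓ-trans (colorLess⇒≺ x q x<q) q≺p))
      (∈-positions 1≤q q≤n) (colorLess-irrefl q) (≺⇒colorLess q p q≺p)

  colorRank<n : ∀ {p} → 1 ≤ p → p ≤ n → colorRank n b p < n
  colorRank<n {p} 1≤p p≤n = subst (colorRank n b p <_) length-positions
    (List.filter-notAll (T? ∘ λ x → colorLess b x p) (positions n)
      (Any.map (λ { refl → colorLess-irrefl p }) (∈-positions 1≤p p≤n)))

  colorRank-injective : ∀ {q p} → 1 ≤ q → q ≤ n → 1 ≤ p → p ≤ n →
                        colorRank n b q ≡ colorRank n b p → q ≡ p
  colorRank-injective {q} {p} 1≤q q≤n 1≤p p≤n same-rank with compare (key q) (key p)
  ... | tri< q≺p _ _ = contradiction same-rank (<⇒≢ (colorRank-mono-≺ {q} {p} 1≤q q≤n q≺p))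
  ... | tri≈ _ (c , s) _ = key-injective 1≤q 1≤p c s
  ... | tri> _ _ p≺q = contradiction same-rank (≢-sym (<⇒≢ (colorRank-mono-≺ {p} {q} 1≤p p≤n p≺q)))

  same-block-close : ∀ {x y} → 1 ≤ x → 1 ≤ y → block x ≡ block y → ∣ x - y ∣ ≤ b
  same-block-close {x} {y} 1≤x 1≤y same-block = begin
    ∣ x - y ∣                        ≡⟨ cong₂ ∣_-_∣ (offset+block 1≤x) y≡ ⟩
    ∣ offset x + t - offset y + t ∣  ≡⟨ ∣m+o-n+o∣≡∣m-n∣ (offset x) (offset y) t ⟩
    ∣ offset x - offset y ∣          ≤⟨ ∣m-n∣≤m⊔n (offset x) (offset y) ⟩
    offset x ⊔ offset y              ≤⟨ ⊔-lub (s≤s⁻¹ (offset<1+b x)) (s≤s⁻¹ (offset<1+b y)) ⟩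
    b                                ∎
    where
      open ≤-Reasoning
      t = block x * suc b
      y≡ : y ≡ suc (offset y + t)
      y≡ = trans (offset+block 1≤y) (cong (λ β → suc (offset y + β * suc b)) (sym same-block))

  next-block-close : ∀ {x y} → 1 ≤ x → 1 ≤ y → block x ≡ suc (block y) → offset x < offset y →
                     ∣ x - y ∣ ≤ b
  next-block-close {x} {y} 1≤x 1≤y next-block ox<oy = begin
    ∣ x - y ∣                                ≡⟨ cong₂ ∣_-_∣ x≡ (offset+block 1≤y) ⟩
    ∣ offset x + suc b + t - offset y + t ∣  ≡⟨ ∣m+o-n+o∣≡∣m-n∣ (offset x + suc b) (offset y) t ⟩
    ∣ offset x + suc b - offset y ∣          ≡⟨ m≤n⇒∣n-m∣≡n∸m oy≤ ⟩
    offset x + suc b ∸ offset y              ≤⟨ m≤n+o⇒m∸n≤o (offset x + suc b) (offset y) gap ⟩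
    b                                        ∎
    where
      open ≤-Reasoning
      t = block y * suc b
      x≡ : x ≡ suc (offset x + suc b + t)
      x≡ = trans (offset+block 1≤x) (cong suc (trans (cong (λ β → offset x + β * suc b) next-block)
                                                     (sym (+-assoc (offset x) (suc b) t))))
      oy≤ : offset y ≤ offset x + suc b
      oy≤ = ≤-trans (<⇒≤ (offset<1+b y)) (m≤n+m (suc b) (offset x))
      gap : offset x + suc b ≤ offset y + b
      gap = subst (_≤ offset y + b) (sym (+-suc (offset x) b)) (+-monoˡ-≤ b ox<oy)

  next-block-≺ : ∀ {x y} → 1 ≤ x → 1 ≤ y → block x ≡ suc (block y) → offset y ≤ offset x →
                 y ≺ x
  next-block-≺ {x} {y} 1≤x 1≤y next-block oy≤ox with m≤n⇒m<n∨m≡n oy≤ox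
  ... | inj₁ oy<ox = inj₁ (s≤s oy<ox)
  ... | inj₂ oy≡ox = inj₂ (cong suc oy≡ox , (begin-strict
      segment b y      ≡⟨ segment≡1+block 1≤y ⟩
      suc (block y)    <⟨ n<1+n _ ⟩
      suc (suc (block y)) ≡⟨ cong suc next-block ⟨
      suc (block x)    ≡⟨ segment≡1+block 1≤x ⟨
      segment b x      ∎))
    where open ≤-Reasoning

  ranked-next-block-close : ∀ {x y} → 1 ≤ x → 1 ≤ y → y ≤ n → block x ≡ suc (block y) →
                            colorRank n b x < colorRank n b y → ∣ x - y ∣ ≤ b
  ranked-next-block-close {x} {y} 1≤x 1≤y y≤n next-block x-first with offset x <? offset y
  ... | yes ox<oy = next-block-close 1≤x 1≤y next-block ox<oy
  ... | no ox≮oy  = contradiction x-first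
        (<⇒≯ (colorRank-mono-≺ {y} {x} 1≤y y≤n (next-block-≺ 1≤x 1≤y next-block (≮⇒≥ ox≮oy))))

  nearby-base-segments-close : ∀ {a c x y} → InBase n b a x → InBase n b c y →
    a ∸ 1 ≤ c → c ≤ a → colorRank n b x < colorRank n b y → ∣ x - y ∣ ≤ b
  nearby-base-segments-close {a} {c} x∈a@(1≤x , _) y∈c@(1≤y , y≤n , _) a-1≤c c≤a x-first
    with pred-≤-adjacent a-1≤c c≤a
  ... | inj₁ refl = same-block-close 1≤x 1≤y
                      (trans (inBase⇒block {a} x∈a) (sym (inBase⇒block {c} y∈c)))
  ... | inj₂ refl = ranked-next-block-close 1≤x 1≤y y≤n
                      (trans (inBase⇒block {a} x∈a) (cong suc (sym (inBase⇒block {c} y∈c)))) x-first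

increasing-bounded⇒≡id : ∀ (d : ℕ → ℕ) n → (∀ k → k < n → d k < d (suc k)) → d n ≤ n →
                         ∀ k → k ≤ n → d k ≡ k
increasing-bounded⇒≡id d n increasing bounded k k≤n = ≤-antisym upper lower
  where
    grows : ∀ k m → k + m ≤ n → d k + m ≤ d (k + m)
    grows k zero    _      = ≤-reflexive (trans (+-identityʳ (d k)) (cong d (sym (+-identityʳ k))))
    grows k (suc m) k+m<n  = begin
      d k + suc m      ≡⟨ +-suc (d k) m ⟩
      suc (d k + m)    ≤⟨ s≤s (grows k m (<⇒≤ k+m<n′)) ⟩
      suc (d (k + m))  ≤⟨ increasing (k + m) k+m<n′ ⟩
      d (suc (k + m))  ≡⟨ cong d (+-suc k m) ⟨
      d (k + suc m)    ∎
      where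
        open ≤-Reasoning
        k+m<n′ : k + m < n
        k+m<n′ = subst (_≤ n) (+-suc k m) k+m<n
    lower : k ≤ d k
    lower = ≤-trans (m≤n+m k (d 0)) (grows 0 k k≤n)
    upper : d k ≤ k
    upper = +-cancelʳ-≤ (n ∸ k) (d k) k (begin
      d k + (n ∸ k)    ≤⟨ grows k (n ∸ k) (≤-reflexive (m+[n∸m]≡n k≤n)) ⟩
      d (k + (n ∸ k))  ≡⟨ cong d (m+[n∸m]≡n k≤n) ⟩
      d n              ≤⟨ bounded ⟩
      n                ≡⟨ m+[n∸m]≡n k≤n ⟨
      k + (n ∸ k)      ∎)
      where open ≤-Reasoning

nothing-to-just-step : ∀ {a} {A : Set a} (f : ℕ → Maybe A) →
                       f 0 ≡ nothing → ∀ {m x} → f m ≡ just x →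
                       ∃[ k ] (k < m × f k ≡ nothing × ∃[ y ] f (suc k) ≡ just y)
nothing-to-just-step f f0 {zero}  fm = contradiction (trans (sym f0) fm) λ ()
nothing-to-just-step f f0 {suc m} {x} fm with f m in fm′
... | nothing = m , ≤-refl , fm′ , x , fm
... | just y  = Product.map id (Product.map m<n⇒m<1+n id) (nothing-to-just-step f f0 fm′)

present⇒is-just : ∀ {a} {A : Set a} {m : Maybe A} {x} → m ≡ just x → T (is-just m)
present⇒is-just refl = tt

absent⇒¬is-just : ∀ {a} {A : Set a} {m : Maybe A} → m ≡ nothing → ¬ T (is-just m)
absent⇒¬is-just refl ()

is-just-mono : ∀ {a} {A : Set a} {m m′ : Maybe A} →
               (∀ {x} → m ≡ just x → m′ ≡ just x) → T (is-just m) → T (is-just m′)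
is-just-mono {m = just x} kept _ = present⇒is-just (kept refl)

module _ {n : ℕ} where

  domSize≤n : ∀ (s : StateCand n) → domSize s ≤ n
  domSize≤n s = subst (domSize s ≤_) (List.length-tabulate id)
                  (List.length-filter (T? ∘ is-just ∘ s) (allFin n))

  domSize≡0⇒empty : ∀ (s : StateCand n) → domSize s ≡ 0 → ∀ v → s v ≡ nothing
  domSize≡0⇒empty s empty v with s v in sv
  ... | nothing = refl
  ... | just x  = contradiction empty (≢-sym (<⇒≢
      (List.filter-some (T? ∘ is-just ∘ s) (Any.map (λ { refl → present⇒is-just sv }) (∈-allFin v)))))

  domSize≡n⇒total : ∀ (s : StateCand n) → domSize s ≡ n → ∀ v → ∃[ x ] s v ≡ just x
  domSize≡n⇒total s full v with s v in sv
  ... | just x  = x , refl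
  ... | nothing = contradiction (trans full (sym (List.length-tabulate id))) (<⇒≢
      (List.filter-notAll (T? ∘ is-just ∘ s) (allFin n)
        (Any.map (λ { refl → absent⇒¬is-just sv }) (∈-allFin v))))

  domSize-< : ∀ (s s′ : StateCand n) → (∀ {u x} → s u ≡ just x → s′ u ≡ just x) →
              ∀ {v i} → s v ≡ nothing → s′ v ≡ just i → domSize s < domSize s′
  domSize-< s s′ kept {v} sv s′v =
    length-filter-mono-< (T? ∘ is-just ∘ s) (T? ∘ is-just ∘ s′) (allFin n)
      (λ {u} _ → is-just-mono {m = s u} {s′ u} kept)
      (∈-allFin v) (absent⇒¬is-just sv) (present⇒is-just s′v)

module _ {n : ℕ} {E : Fin n → Fin n → Set} {b : ℕ} {D : RootedSpanningTree E}
         (φ : SegmentAssignment b D) where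
  open Positions n b

  new-vertex-position : ∀ {s s′ : StateCand n} {v i p} → IsState φ s → IsState φ s′ →
    domSize s′ ≡ suc (domSize s) → s′ v ≡ just i → (∀ u → u ≢ v → s′ u ≡ s u) →
    1 ≤ p → p ≤ n → colorRank n b p ≡ domSize s → InBase n b i p
  new-vertex-position {s} {s′} {v} {i} {p}
                      (_ , (f , f-seg , f-inj , _) , _) (_ , (f′ , f′-seg , _ , f′-onto) , _)
                      grown s′v others 1≤p p≤n p-rank
    with block p ℕ.≟ i
  ... | yes refl = inBase-block 1≤p p≤n
  ... | no j≢i   = contradiction (proj₂ p-early) (≤⇒≯ (≤-reflexive (sym p-rank)))
    where
      j = block p
      k = domSize s

      Early : ℕ → ℕ → Set
      Early m q = InBase n b j q × colorRank n b q < m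

      origin : ∀ {q} → Early (suc k) q → Σ (Fin n) λ u → s u ≡ just j × f′ u ≡ q
      origin {q} (q∈j , q-early)
        with f′-onto q (proj₁ q∈j) (proj₁ (proj₂ q∈j)) (subst (colorRank n b q <_) (sym grown) q-early)
      ... | u , x , s′u , f′u≡q =
        u , trans (sym (others u u≢v)) (trans s′u (cong just x≡j)) , f′u≡q
        where
          x≡j : x ≡ j
          x≡j = trans (sym (inBase⇒block {x} (subst (InBase n b x) f′u≡q (proj₁ (f′-seg u x s′u)))))
                      (inBase⇒block {j} q∈j)
          u≢v : u ≢ v
          u≢v refl = j≢i (trans (sym x≡j) (just-injective (trans (sym s′u) s′v)))

      g : ∀ {q} → Early (suc k) q → ℕ
      g = f ∘ proj₁ ∘ origin

      g-into : ∀ {q} → q < suc n → (e : Early (suc k) q) → g e < suc n × Early k (g e)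
      g-into _ e = let (u , su , _) = origin e ; (fu∈j , fu-early) = f-seg u j su in
        s≤s (proj₁ (proj₂ fu∈j)) , fu∈j , fu-early

      g-injective : ∀ {q q′} (e : Early (suc k) q) (e′ : Early (suc k) q′) →
                    g e ≡ g e′ → q ≡ q′
      g-injective {q} {q′} e e′ same =
        let (u , su , f′u≡q) = origin e ; (u′ , su′ , f′u′≡q′) = origin e′ in begin
          q     ≡⟨ f′u≡q ⟨
          f′ u  ≡⟨ cong f′ (f-inj u u′ j j su su′ same) ⟩
          f′ u′ ≡⟨ f′u′≡q′ ⟩
          q′    ∎
        where open ≡-Reasoning

      p-early : Early k p
      p-early = no-injection-into-proper-subset
        (λ q → inBase? j q ×-dec (colorRank n b q <? suc k))
        (λ q → inBase? j q ×-dec (colorRank n b q <? k))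
        (suc n) (Product.map id m<n⇒m<1+n) g g-into g-injective
        (s≤s p≤n) (inBase-block 1≤p p≤n , subst (_< suc k) (sym p-rank) ≤-refl)

module Insertions {n : ℕ} {E : Fin n → Fin n → Set} {b : ℕ} {D : RootedSpanningTree E}
                  (φ : SegmentAssignment b D) (s : ℕ → StateCand n)
                  (states : ∀ k → k ≤ n → IsState φ (s k))
                  (extensions : ∀ k → k < n → IsExtension φ (s k) (s (suc k))) where

  InsertedAt : Fin n → ℕ → Set
  InsertedAt v k = s k v ≡ nothing × ∃[ i ] s (suc k) v ≡ just i

  inserted-vertex : ∀ {k} → k < n → Fin n
  inserted-vertex {k} k<n = proj₁ (extensions k k<n)

  inserted-vertex-absent : ∀ {k} (k<n : k < n) → s k (inserted-vertex k<n) ≡ nothing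
  inserted-vertex-absent {k} k<n = proj₁ (proj₂ (extensions k k<n))

  unchanged : ∀ {k} (k<n : k < n) u → u ≢ inserted-vertex k<n → s (suc k) u ≡ s k u
  unchanged {k} k<n = proj₁ (proj₂ (proj₂ (proj₂ (extensions k k<n))))

  inserted⇒extension-vertex : ∀ {k v} (k<n : k < n) → InsertedAt v k → v ≡ inserted-vertex k<n
  inserted⇒extension-vertex {k} {v} k<n (absent , i , present) with v Fin.≟ inserted-vertex k<n
  ... | yes v≡w = v≡w
  ... | no v≢w  = contradiction (trans (sym present) (trans (unchanged k<n v v≢w) absent)) λ ()

  kept : ∀ {k u x} → k < n → s k u ≡ just x → s (suc k) u ≡ just x
  kept {k} {u} k<n su with u Fin.≟ inserted-vertex k<n
  ... | yes refl = contradiction (trans (sym su) (inserted-vertex-absent k<n)) λ ()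
  ... | no u≢w   = trans (unchanged k<n u u≢w) su

  kept-until : ∀ {k k′ u x} → k ≤ k′ → k′ ≤ n → s k u ≡ just x → s k′ u ≡ just x
  kept-until {k} {k′} k≤k′ k′≤n su with m≤n⇒m<n∨m≡n k≤k′
  ... | inj₂ refl = su
  ... | inj₁ (s≤s k≤k″) = kept k′≤n (kept-until k≤k″ (<⇒≤ k′≤n) su)

  domSize≡stage : ∀ {k} → k ≤ n → domSize (s k) ≡ k
  domSize≡stage {k} = increasing-bounded⇒≡id (domSize ∘ s) n grows (domSize≤n (s n)) k
    where
      grows : ∀ k → k < n → domSize (s k) < domSize (s (suc k))
      grows k k<n = let (_ , absent , (_ , present) , _) = extensions k k<n in
        domSize-< (s k) (s (suc k)) (kept k<n) absent present

  record Insertion (v : Fin n) : Set where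
    field
      stage   : ℕ
      stage<n : stage < n
      absent  : s stage v ≡ nothing
      index   : ℕ
      present : s (suc stage) v ≡ just index

  insertion : ∀ v → Insertion v
  insertion v with nothing-to-just-step (λ k → s k v) (domSize≡0⇒empty (s 0) (domSize≡stage z≤n) v)
                                   (proj₂ (domSize≡n⇒total (s n) (domSize≡stage ≤-refl) v))
  ... | k , k<n , absent , i , present =
    record { stage = k ; stage<n = k<n ; absent = absent ; index = i ; present = present }

  inserted-unique : ∀ {k u v} (k<n : k < n) → InsertedAt u k → InsertedAt v k → u ≡ v
  inserted-unique k<n u-new v-new =
    trans (inserted⇒extension-vertex k<n u-new) (sym (inserted⇒extension-vertex k<n v-new))

  inserted-position : ∀ {k v i p} → k < n → s k v ≡ nothing → s (suc k) v ≡ just i →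
                      1 ≤ p → p ≤ n → colorRank n b p ≡ k → InBase n b i p
  inserted-position {k} {v} {i} k<n absent present 1≤p p≤n p-rank =
    new-vertex-position φ (states k (<⇒≤ k<n)) (states (suc k) k<n)
      (trans (domSize≡stage k<n) (cong suc (sym (domSize≡stage (<⇒≤ k<n)))))
      present others 1≤p p≤n (trans p-rank (sym (domSize≡stage (<⇒≤ k<n))))
    where
      others : ∀ u → u ≢ v → s (suc k) u ≡ s k u
      others u u≢v = unchanged k<n u
        (u≢v ∘ λ u≡w → trans u≡w (sym (inserted⇒extension-vertex k<n (absent , i , present))))

  earlier-neighbour-segments : ∀ {u v k k′ a c} → E u v → k < k′ → (k′<n : k′ < n) →
    s (suc k) u ≡ just a → s k′ v ≡ nothing → s (suc k′) v ≡ just c → a ∸ 1 ≤ c × c ≤ a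
  earlier-neighbour-segments {u} {v} {k} {k′} {a} {c} e k<k′ k′<n su absent present
    with inserted⇒extension-vertex k′<n (absent , c , present)
  ... | refl = let (_ , _ , _ , _ , close) = extensions k′ k′<n in
                 close u a c e (kept-until (m≤n⇒m≤1+n k<k′) k′<n su) present

module Ordering {n : ℕ} {E : Fin n → Fin n → Set} (G : SimpleGraph E) {b : ℕ} {D : RootedSpanningTree E}
                (φ : SegmentAssignment b D) (s : ℕ → StateCand n)
                (states : ∀ k → k ≤ n → IsState φ (s k))
                (extensions : ∀ k → k < n → IsExtension φ (s k) (s (suc k)))
                (π : Fin n → ℕ)
                (π-rank : ∀ k v → k < n → s k v ≡ nothing → ∃[ i ] (s (suc k) v ≡ just i)
                          → (1 ≤ π v) × (π v ≤ n) × (colorRank n b (π v) ≡ k)) where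
  open Positions n b
  open Insertions φ s states extensions
  module Inserted (v : Fin n) = Insertion (insertion v)
  open Inserted

  inserted-at-stage : ∀ v → InsertedAt v (stage v)
  inserted-at-stage v = absent v , index v , present v

  π-placed : ∀ v → (1 ≤ π v) × (π v ≤ n) × (colorRank n b (π v) ≡ stage v)
  π-placed v = π-rank (stage v) v (stage<n v) (absent v) (index v , present v)

  π-in-segment : ∀ v → InBase n b (index v) (π v)
  π-in-segment v = let (1≤π , π≤n , rank) = π-placed v in
    inserted-position (stage<n v) (absent v) (present v) 1≤π π≤n rank

  same-stage⇒≡ : ∀ {u v} → stage u ≡ stage v → u ≡ v
  same-stage⇒≡ {u} {v} same = inserted-unique (stage<n u) (inserted-at-stage u)
    (subst (InsertedAt v) (sym same) (inserted-at-stage v))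

  π-injective : ∀ u v → π u ≡ π v → u ≡ v
  π-injective u v same = same-stage⇒≡ (begin
    stage u                ≡⟨ proj₂ (proj₂ (π-placed u)) ⟨
    colorRank n b (π u)    ≡⟨ cong (colorRank n b) same ⟩
    colorRank n b (π v)    ≡⟨ proj₂ (proj₂ (π-placed v)) ⟩
    stage v                ∎)
    where open ≡-Reasoning

  π-surjective : ∀ p → 1 ≤ p → p ≤ n → ∃[ v ] (π v ≡ p)
  π-surjective p 1≤p p≤n =
    let k<n = colorRank<n 1≤p p≤n
        (w , w-absent , w-present , _) = extensions (colorRank n b p) k<n
        (1≤π , π≤n , w-rank) = π-rank (colorRank n b p) w k<n w-absent w-present
    in w , colorRank-injective 1≤π π≤n 1≤p p≤n w-rank

  earlier-neighbour-close : ∀ {u v} → E u v → stage u < stage v → ∣ π u - π v ∣ ≤ b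
  earlier-neighbour-close {u} {v} e u-first =
    let (a-1≤c , c≤a) = earlier-neighbour-segments e u-first (stage<n v) (present u) (absent v) (present v) in
    nearby-base-segments-close (π-in-segment u) (π-in-segment v) a-1≤c c≤a
      (subst₂ _<_ (sym (proj₂ (proj₂ (π-placed u)))) (sym (proj₂ (proj₂ (π-placed v)))) u-first)

  π-bandwidth : ∀ u v → E u v → ∣ π u - π v ∣ ≤ b
  π-bandwidth u v e with <-cmp (stage u) (stage v)
  ... | tri< u-first _ _ = earlier-neighbour-close e u-first
  ... | tri> _ _ v-first = subst (_≤ b) (∣-∣-comm (π v) (π u))
                             (earlier-neighbour-close (SimpleGraph.sym G u v e) v-first)
  ... | tri≈ _ same _ with same-stage⇒≡ {u} {v} same
  ...   | refl = subst (_≤ b) (sym (∣n-n∣≡0 (π u))) z≤n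

  isBOrdering : IsBOrdering E b π
  isBOrdering = (λ v → proj₁ (π-placed v) , proj₁ (proj₂ (π-placed v)))
              , π-injective , π-surjective , π-bandwidth

lemma5 : ∀ {n : ℕ} (E : Fin n → Fin n → Set) → SimpleGraph E → Connected E → 2 ≤ n
       → (b : ℕ) → 1 ≤ b → b < n
       → (D : RootedSpanningTree E) (φ : SegmentAssignment b D)
       → (s : ℕ → StateCand n)
       → (∀ k → k ≤ n → IsState φ (s k))
       → (∀ k → k < n → IsExtension φ (s k) (s (suc k)))
       → (π : Fin n → ℕ)
       → (∀ k v → k < n → s k v ≡ nothing → ∃[ i ] (s (suc k) v ≡ just i)
            → (1 ≤ π v) × (π v ≤ n) × (colorRank n b (π v) ≡ k))
       → IsBOrdering E b π
lemma5 E G _ _ b _ _ _ φ s states extensions π π-rank =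
  Ordering.isBOrdering G φ s states extensions π π-rank
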